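{- For every graph $G$ (possibly with loops) and every integer $p\ge2$, $h(C_G^p)=p\cdot h(G)$.
   Context: Graphs are finite, undirected, with no parallel edges and no isolated vertices, possibly with loops. $C_G^p$ is the tensor product of $G$ with the complete graph with loops on $p$ vertices: its vertex set is $\{v^i: v\in V(G),\ i\in[p]\}$, and $v^iw^j$ is an edge for all $i,j\in[p]$ whenever $vw\in E(G)$ (including $v=w$ for loops, and $i=j$). For $A\subseteq V$, $N(A)$ is the set of vertices having a neighbor in $A$. A hunter strategy $(W_t)_{t\ge1}$ gives rabbit territory $R_1=V\setminus W_1$, $R_t=N(R_{t-1})\setminus W_t$; it is winning if $R_T=\emptyset$ for some finite $T$; $h(G)$ is the minimum $k$ such that a winning strategy with $|W_t|\le k$ for all $t$ exists. -}

module Defs where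

open import Data.Nat using (ℕ; zero; suc; _*_; _≤_)
open import Data.Bool using (Bool; T)
open import Data.Fin using (Fin; remQuot; combine)
open import Data.Fin.Properties using (remQuot-combine)
open import Data.Fin.Subset using (Subset; _∈_; _∉_; ∣_∣)
open import Data.Product using (Σ; ∃; _×_; _,_; proj₁; proj₂)
open import Relation.Nullary using (¬_)
open import Relation.Binary.PropositionalEquality using (_≡_; cong; sym; subst)

record Graph : Set where
  field
    n          : ℕ
    adj        : Fin n → Fin n → Bool
    symmetric  : ∀ v w → adj v w ≡ adj w v
    noIsolated : ∀ v → ∃ λ w → T (adj v w)

open Graph public

Vertex : Graph → Set
Vertex G = Fin (n G)

Edge : (G : Graph) → Vertex G → Vertex G → Set
Edge G v w = T (adj G v w)

-- C_G^p : tensor product of G with the complete graph with loops on p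
-- vertices.  The vertex v^i (v ∈ V(G), i ∈ Fin p) is encoded as
-- combine v i : Fin (n * p), decoded by remQuot p.  v^i w^j is an edge
-- iff vw is an edge of G (for all i, j).
CGp : Graph → ℕ → Graph
CGp G p = record
  { n          = n G * p
  ; adj        = λ x y → adj G (proj₁ (remQuot {n G} p x)) (proj₁ (remQuot {n G} p y))
  ; symmetric  = λ x y → symmetric G (proj₁ (remQuot {n G} p x)) (proj₁ (remQuot {n G} p y))
  ; noIsolated = λ x →
      let v = proj₁ (remQuot {n G} p x) ; i = proj₂ (remQuot {n G} p x)
          w = proj₁ (noIsolated G v)
      in combine w i
         , subst (λ u → T (adj G v u))
                 (sym (cong proj₁ (remQuot-combine {n = n G} {k = p} w i)))
                 (proj₂ (noIsolated G v))
  }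

-- Hunter strategy: W t is the hunters' shot set at round t+1
-- (rounds are indexed from 0 here instead of from 1).
Strategy : Graph → Set
Strategy G = ℕ → Subset (n G)

N : (G : Graph) → (Vertex G → Set) → Vertex G → Set
N G A v = ∃ λ w → A w × Edge G v w

Territory : (G : Graph) → Strategy G → ℕ → Vertex G → Set
Territory G W zero    v = v ∉ W zero
Territory G W (suc t) v = N G (Territory G W t) v × v ∉ W (suc t)

Winning : (G : Graph) → Strategy G → Set
Winning G W = ∃ λ T → ∀ v → ¬ Territory G W T v

WinsWith : (G : Graph) → ℕ → Set
WinsWith G k = Σ (Strategy G) λ W → (∀ t → ∣ W t ∣ ≤ k) × Winning G W

IsHunterNumber : Graph → ℕ → Set
IsHunterNumber G k = WinsWith G k × (∀ k′ → WinsWith G k′ → k ≤ k′)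

{-# OPTIONS --safe #-}
-- The projection v^i ↦ v is a homomorphism C_G^p → G, so if every vertex shot by a
-- winning strategy on G is replaced by all its p copies, the rabbit in C_G^p stays on
-- copies of its territory in G: p·h(G) hunters suffice.  Conversely, a strategy on C_G^p
-- with k′ hunters induces one on G that shoots v exactly when all p copies of v are shot.
-- It uses at most ⌊k′/p⌋ hunters, and every vertex it leaves unshot has an unshot copy,
-- so its rabbit territory lifts along copies and it wins: h(G) ≤ ⌊k′/p⌋.
module Submission where

open import Defs
open import Data.Nat using (ℕ; _*_; _≤_)
open import Data.Nat using (zero; suc; _+_; z≤n; NonZero)
open import Data.Nat.Properties
open import Data.Nat.DivMod using (_/_; m/n*n≤m; m*n/n≡m; /-monoˡ-≤)
open import Data.Fin using (Fin; remQuot; combine)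
open import Data.Fin.Properties using (remQuot-combine; combine-remQuot; ¬∀⟶∃¬)
open import Data.Fin.Subset using (Subset; inside; outside; _∈_; _∉_; ∣_∣; ⊤; ⊥)
open import Data.Fin.Subset.Properties using (_∈?_; _⊆?_; ∣⊤∣≡n; ∣⊥∣≡0; p⊆q⇒∣p∣≤∣q∣)
open import Data.Vec using (Vec; []; _∷_; _++_; lookup; map; replicate; concat; group)
open import Data.Vec.Properties using ([]=⇒lookup; lookup⇒[]=; lookup-map; lookup-replicate; lookup-concat)
open import Data.Product using (∃; _,_; proj₁; proj₂)
open import Function using (_∘_)
open import Relation.Nullary using (yes; no; does; contradiction)
open import Relation.Binary.PropositionalEquality

∈-resp-lookup : ∀ {m m′} {S : Subset m} {T : Subset m′} {x y} →
                lookup S x ≡ lookup T y → x ∈ S → y ∈ T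
∈-resp-lookup {T = T} {y = y} eq x∈S = lookup⇒[]= y T (trans (sym eq) ([]=⇒lookup x∈S))

∣p++q∣≡∣p∣+∣q∣ : ∀ {m m′} (S : Subset m) (T : Subset m′) → ∣ S ++ T ∣ ≡ ∣ S ∣ + ∣ T ∣
∣p++q∣≡∣p∣+∣q∣ []            T = refl
∣p++q∣≡∣p∣+∣q∣ (inside  ∷ S) T = cong suc (∣p++q∣≡∣p∣+∣q∣ S T)
∣p++q∣≡∣p∣+∣q∣ (outside ∷ S) T = ∣p++q∣≡∣p∣+∣q∣ S T

inflate : ∀ {m} k → Subset m → Subset (m * k)
inflate k S = concat (map (replicate k) S)

∣inflate∣≡k*∣S∣ : ∀ {m} k (S : Subset m) → ∣ inflate k S ∣ ≡ k * ∣ S ∣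
∣inflate∣≡k*∣S∣ k []            = sym (*-zeroʳ k)
∣inflate∣≡k*∣S∣ k (inside  ∷ S) = begin
  ∣ ⊤ {k} ++ inflate k S ∣     ≡⟨ ∣p++q∣≡∣p∣+∣q∣ (⊤ {k}) (inflate k S) ⟩
  ∣ ⊤ {k} ∣ + ∣ inflate k S ∣  ≡⟨ cong₂ _+_ (∣⊤∣≡n k) (∣inflate∣≡k*∣S∣ k S) ⟩
  k + k * ∣ S ∣                ≡⟨ *-suc k ∣ S ∣ ⟨
  k * suc ∣ S ∣                ∎
  where open ≡-Reasoning
∣inflate∣≡k*∣S∣ k (outside ∷ S) = begin
  ∣ ⊥ {k} ++ inflate k S ∣     ≡⟨ ∣p++q∣≡∣p∣+∣q∣ (⊥ {k}) (inflate k S) ⟩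
  ∣ ⊥ {k} ∣ + ∣ inflate k S ∣  ≡⟨ cong₂ _+_ (∣⊥∣≡0 k) (∣inflate∣≡k*∣S∣ k S) ⟩
  k * ∣ S ∣                    ∎
  where open ≡-Reasoning

lookup-inflate : ∀ {m} k (S : Subset m) x →
                 lookup (inflate k S) x ≡ lookup S (proj₁ (remQuot {m} k x))
lookup-inflate {m} k S x = begin
  lookup (inflate k S) x                      ≡⟨ cong (lookup (inflate k S)) (combine-remQuot {m} k x) ⟨
  lookup (inflate k S) (combine i j)          ≡⟨ lookup-concat (map (replicate k) S) i j ⟩
  lookup (lookup (map (replicate k) S) i) j   ≡⟨ cong (λ b → lookup b j) (lookup-map i (replicate k) S) ⟩
  lookup (replicate k (lookup S i)) j         ≡⟨ lookup-replicate j (lookup S i) ⟩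
  lookup S i                                  ∎
  where
  open ≡-Reasoning
  i = proj₁ (remQuot {m} k x)
  j = proj₂ (remQuot {m} k x)

∉-inflate : ∀ {m} k (S : Subset m) {x} → x ∉ inflate k S → proj₁ (remQuot {m} k x) ∉ S
∉-inflate k S {x} x∉ = x∉ ∘ ∈-resp-lookup (sym (lookup-inflate k S x))

blocks : ∀ m k → Subset (m * k) → Vec (Subset k) m
blocks m k S = proj₁ (group m k S)

concat-blocks : ∀ m k (S : Subset (m * k)) → concat (blocks m k S) ≡ S
concat-blocks m k S = sym (proj₂ (group m k S))

lookup-blocks : ∀ m k (S : Subset (m * k)) i j →
                lookup (lookup (blocks m k S) i) j ≡ lookup S (combine i j)
lookup-blocks m k S i j = begin
  lookup (lookup (blocks m k S) i) j              ≡⟨ lookup-concat (blocks m k S) i j ⟨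
  lookup (concat (blocks m k S)) (combine i j)    ≡⟨ cong (λ T → lookup T (combine i j)) (concat-blocks m k S) ⟩
  lookup S (combine i j)                          ∎
  where open ≡-Reasoning

deflateBlocks : ∀ {m k} → Vec (Subset k) m → Subset m
deflateBlocks = map (λ b → does (⊤ ⊆? b))

deflate : ∀ m k → Subset (m * k) → Subset m
deflate m k = deflateBlocks ∘ blocks m k

∣deflateBlocks∣*k≤∣concat∣ : ∀ {m} k (bs : Vec (Subset k) m) →
                             ∣ deflateBlocks bs ∣ * k ≤ ∣ concat bs ∣
∣deflateBlocks∣*k≤∣concat∣ k []       = z≤n
∣deflateBlocks∣*k≤∣concat∣ k (b ∷ bs) with ⊤ ⊆? b
... | yes ⊤⊆b = begin
  k + ∣ deflateBlocks bs ∣ * k  ≤⟨ +-mono-≤ (subst (_≤ ∣ b ∣) (∣⊤∣≡n k) (p⊆q⇒∣p∣≤∣q∣ ⊤⊆b))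
                                           (∣deflateBlocks∣*k≤∣concat∣ k bs) ⟩
  ∣ b ∣ + ∣ concat bs ∣         ≡⟨ ∣p++q∣≡∣p∣+∣q∣ b (concat bs) ⟨
  ∣ b ++ concat bs ∣            ∎
  where open ≤-Reasoning
... | no _ = begin
  ∣ deflateBlocks bs ∣ * k  ≤⟨ ∣deflateBlocks∣*k≤∣concat∣ k bs ⟩
  ∣ concat bs ∣             ≤⟨ m≤n+m ∣ concat bs ∣ ∣ b ∣ ⟩
  ∣ b ∣ + ∣ concat bs ∣     ≡⟨ ∣p++q∣≡∣p∣+∣q∣ b (concat bs) ⟨
  ∣ b ++ concat bs ∣        ∎
  where open ≤-Reasoning

∣deflate∣*k≤∣S∣ : ∀ m k (S : Subset (m * k)) → ∣ deflate m k S ∣ * k ≤ ∣ S ∣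
∣deflate∣*k≤∣S∣ m k S =
  subst (∣ deflate m k S ∣ * k ≤_) (cong ∣_∣ (concat-blocks m k S))
        (∣deflateBlocks∣*k≤∣concat∣ k (blocks m k S))

∉-deflate : ∀ m k (S : Subset (m * k)) i → i ∉ deflate m k S → ∃ λ j → combine i j ∉ S
∉-deflate m k S i i∉ with ⊤ ⊆? lookup (blocks m k S) i in eq
... | yes _  = contradiction (lookup⇒[]= i _ (trans (lookup-map i _ (blocks m k S)) (cong does eq))) i∉
... | no ⊤⊈b with ¬∀⟶∃¬ k (_∈ b) (_∈? b) (λ ∀∈ → ⊤⊈b (λ {j} _ → ∀∈ j))
  where b = lookup (blocks m k S) i
...   | j , j∉b = j , j∉b ∘ ∈-resp-lookup (sym (lookup-blocks m k S i j))

m*n≤o⇒m≤o/n : ∀ {m n o} .{{_ : NonZero n}} → m * n ≤ o → m ≤ o / n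
m*n≤o⇒m≤o/n {m} {n} m*n≤o = subst (_≤ _) (m*n/n≡m m n) (/-monoˡ-≤ n m*n≤o)

m≤o/n⇒n*m≤o : ∀ {m n o} .{{_ : NonZero n}} → m ≤ o / n → n * m ≤ o
m≤o/n⇒n*m≤o {m} {n} {o} m≤o/n = begin
  n * m      ≡⟨ *-comm n m ⟩
  m * n      ≤⟨ *-monoˡ-≤ n m≤o/n ⟩
  o / n * n  ≤⟨ m/n*n≤m o n ⟩
  o          ∎
  where open ≤-Reasoning

module _ (G : Graph) (p : ℕ) where

  base : Vertex (CGp G p) → Vertex G
  base x = proj₁ (remQuot {n G} p x)

  copy : Vertex G → Fin p → Vertex (CGp G p)
  copy = combine

  base-copy : ∀ v i → base (copy v i) ≡ v
  base-copy v i = cong proj₁ (remQuot-combine {n G} {p} v i)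

  Edge-copy : ∀ {v w} i j → Edge G v w → Edge (CGp G p) (copy v i) (copy w j)
  Edge-copy {v} {w} i j = subst₂ (Edge G) (sym (base-copy v i)) (sym (base-copy w j))

  Territory-inflate : (W : Strategy G) → ∀ t x →
                      Territory (CGp G p) (inflate p ∘ W) t x → Territory G W t (base x)
  Territory-inflate W zero    x x∉                   = ∉-inflate p (W zero) x∉
  Territory-inflate W (suc t) x ((y , y∈R , xy) , x∉) =
    (base y , Territory-inflate W t y y∈R , xy) , ∉-inflate p (W (suc t)) x∉

  Territory-deflate : (W : Strategy (CGp G p)) → ∀ t v →
                      Territory G (deflate (n G) p ∘ W) t v →
                      ∃ λ i → Territory (CGp G p) W t (copy v i)
  Territory-deflate W zero    v v∉                   = ∉-deflate (n G) p (W zero) v v∉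
  Territory-deflate W (suc t) v ((u , u∈R , vu) , v∉)
    with Territory-deflate W t u u∈R | ∉-deflate (n G) p (W (suc t)) v v∉
  ... | j , uj∈R | i , vi∉ = i , (copy u j , uj∈R , Edge-copy i j vu) , vi∉

  inflate-wins : ∀ {k} → WinsWith G k → WinsWith (CGp G p) (p * k)
  inflate-wins (W , ∣W∣≤k , T , R-empty) =
    inflate p ∘ W ,
    (λ t → subst (_≤ _) (sym (∣inflate∣≡k*∣S∣ p (W t))) (*-monoʳ-≤ p (∣W∣≤k t))) ,
    T , λ x x∈R → R-empty (base x) (Territory-inflate W T x x∈R)

  deflate-wins : ∀ {k} .{{_ : NonZero p}} → WinsWith (CGp G p) k → WinsWith G (k / p)
  deflate-wins (W , ∣W∣≤k , T , R-empty) =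
    deflate (n G) p ∘ W ,
    (λ t → m*n≤o⇒m≤o/n (≤-trans (∣deflate∣*k≤∣S∣ (n G) p (W t)) (∣W∣≤k t))) ,
    T , λ v v∈R → let i , vi∈R = Territory-deflate W T v v∈R in R-empty (copy v i) vi∈R

lemma3 : (G : Graph) → (p : ℕ) → 2 ≤ p →
    ∀ k → IsHunterNumber G k → IsHunterNumber (CGp G p) (p * k)
lemma3 G zero ()
lemma3 G p@(suc _) _ k (k-wins , k-minimal) =
  inflate-wins G p k-wins ,
  λ k′ k′-wins → m≤o/n⇒n*m≤o (k-minimal (k′ / p) (deflate-wins G p k′-wins))
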